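{- Suppose that $(S,\mathsf{IN})$ admits weak couplings, and let $(X,\vartheta)$ be a $B_N$-coalgebra. Then the behaviour order $\le_!$ on the states of the discrete $B_M$-coalgebra $(X,=,\vartheta)$ is a simulation on $(X,\vartheta)$.
   Context: An inequational theory $(S,\mathsf{IN})$ (not necessarily iterative) consists of, for each $n\in\mathbb N$, a poset $(I_n,\le_n)$ of $n$-ary operation symbols and a set $\mathsf{IN}$ of pairs of $S$-terms. For a poset $(X,\le)$, $\sqsubseteq_{\mathsf{IN}}$ is the least preorder on $S$-terms over $X$ with: $x\sqsubseteq_{\mathsf{IN}}y$ if $x\le y$; $\sigma(\vec p)\sqsubseteq_{\mathsf{IN}}\sigma(\vec q)$ if $p_i\sqsubseteq_{\mathsf{IN}}q_i$; $\sigma_1(\vec p)\sqsubseteq_{\mathsf{IN}}\sigma_2(\vec p)$ if $\sigma_1\le_n\sigma_2$; $p(\vec r)\sqsubseteq_{\mathsf{IN}}q(\vec r)$ for $(p,q)\in\mathsf{IN}$. $M(X,\le)$ is the poset of $\equiv_{\mathsf{IN}}$-classes ordered by $\sqsubseteq_{\mathsf{IN}}$; $M$ is a functor on posets, $M(h)$ renaming variables along $h$; $x\sqsubseteq_{\mathsf{IN}}y$ implies $x\le y$ for variables. $\mathsf{Var}$ (return variables, infinite) and $\mathsf{Act}$ (actions) are discretely ordered sets; $B_M(X,\le)=M((\mathsf{Var},=)+(\mathsf{Act},=)\times(X,\le))$, whose elements are terms in return variables and pairs $\langle\mathsf a,x\rangle$. With $U$ the forgetful functor from posets to sets and $D$ the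 discrete-order functor, $N=UMD$ and $B_N=N(\mathsf{Var}+\mathsf{Act}\times(-))$; a $B_N$-coalgebra $(X,\vartheta)$, $\vartheta:X\to B_NX$, is also a monotone $B_M$-coalgebra $(X,=,\vartheta)$. For states $x,y$ of $(X,=,\vartheta)$, $x\le_!y$ iff there are a $B_M$-coalgebra $(Y,\le,\delta)$ and monotone homomorphisms $h_1,h_2:(X,=,\vartheta)\to(Y,\le,\delta)$ ($\delta\circ h_i=B_M(h_i)\circ\vartheta$) with $h_1(x)\le h_2(y)$. A relation $R\subseteq X\times X$ is a simulation on $(X,\vartheta)$ if for every $(x,y)\in R$ there is a term $p(\vec{\mathsf v},\langle\mathsf a_1,(x_1,y_1)\rangle,\dots,\langle\mathsf a_n,(x_n,y_n)\rangle)$ with $\vec{\mathsf v}$ in $\mathsf{Var}$, $\mathsf a_i\in\mathsf{Act}$ and $(x_i,y_i)\in R$, such that $\vartheta(x)\sqsubseteq_{\mathsf{IN}}p(\vec{\mathsf v},\langle\mathsf a_i,x_i\rangle_{i\le n})$ and $p(\vec{\mathsf v},\langle\mathsf a_i,y_i\rangle_{i\le n})\sqsubseteq_{\mathsf{IN}}\vartheta(y)$. $(S,\mathsf{IN})$ admits weak couplings if for every monotone $h:(X,\le)\to(Y,\le)$ and all $p(\vec x),q(\vec y)\in M(X,\le)$ with $M(h)(p)\sqsubseteq_{\mathsf{IN}}M(h)(q)$, there is a term $r((u_1,v_1),\dots,(u_n,v_n))$ over pairs in $X\times X$ with $p\sqsubseteq_{\mathsf{IN}}r(u_1,\dots,u_n)$,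 $r(v_1,\dots,v_n)\sqsubseteq_{\mathsf{IN}}q$, and $h(u_i)\le h(v_i)$ for every $i\le n$ (a weak $h$-coupling of $p$ with $q$). -}

module Defs where

open import Data.Nat using (ℕ)
open import Data.Fin using (Fin)
open import Data.Product using (Σ; Σ-syntax; _×_; _,_; proj₁; proj₂)
open import Data.Sum using (_⊎_; inj₁; inj₂)
open import Data.Empty using (⊥)
open import Data.Unit using (⊤)
open import Level using (Lift)
open import Relation.Binary.PropositionalEquality using (_≡_)
open import Relation.Binary.Structures using (IsPartialOrder)
open import Function.Definitions using (Injective)

record Pos : Set₁ where
  field
    Carrier        : Set
    _≤_            : Carrier → Carrier → Set
    isPartialOrder : IsPartialOrder _≡_ _≤_

open Pos public using (Carrier)

record Signature : Set₁ where
  field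
    Op     : ℕ → Set
    _≤op_  : ∀ {n} → Op n → Op n → Set
    isPOop : ∀ n → IsPartialOrder (_≡_ {A = Op n}) (_≤op_ {n})

open Signature public

data Term (S : Signature) (X : Set) : Set where
  var : X → Term S X
  op  : ∀ {n} → Op S n → (Fin n → Term S X) → Term S X

tmap : ∀ {S X Y} → (X → Y) → Term S X → Term S Y
tmap f (var x)   = var (f x)
tmap f (op o ts) = op o (λ i → tmap f (ts i))

bind : ∀ {S X Y} → (X → Term S Y) → Term S X → Term S Y
bind σ (var x)   = σ x
bind σ (op o ts) = op o (λ i → bind σ (ts i))

record Theory : Set₁ where
  field
    S  : Signature
    IN : Term S ℕ → Term S ℕ → Set

open Theory public

AllVars : ∀ {ℓ S X} → (X → Set ℓ) → Term S X → Set ℓ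
AllVars P (var x)   = P x
AllVars P (op o ts) = ∀ i → AllVars P (ts i)

data Le (T : Theory) {X : Set} (_≤_ : X → X → Set) : Term (S T) X → Term (S T) X → Set where
  ⊑-var   : ∀ {x y} → x ≤ y → Le T _≤_ (var x) (var y)
  ⊑-cong  : ∀ {n} (o : Op (S T) n) {ps qs : Fin n → Term (S T) X} →
            (∀ i → Le T _≤_ (ps i) (qs i)) → Le T _≤_ (op o ps) (op o qs)
  ⊑-op    : ∀ {n} {o₁ o₂ : Op (S T) n} (ps : Fin n → Term (S T) X) →
            _≤op_ (S T) o₁ o₂ → Le T _≤_ (op o₁ ps) (op o₂ ps)
  ⊑-ax    : ∀ {p q} → IN T p q → (σ : ℕ → Term (S T) X) →
            Le T _≤_ (bind σ p) (bind σ q)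
  ⊑-refl  : ∀ {p} → Le T _≤_ p p
  ⊑-trans : ∀ {p q r} → Le T _≤_ p q → Le T _≤_ q r → Le T _≤_ p r

Eq : (T : Theory) {X : Set} (_≤_ : X → X → Set) → Term (S T) X → Term (S T) X → Set
Eq T _≤_ p q = Le T _≤_ p q × Le T _≤_ q p

Monotone : (P Q : Pos) → (Carrier P → Carrier Q) → Set
Monotone P Q h = ∀ {x y} → Pos._≤_ P x y → Pos._≤_ Q (h x) (h y)

AdmitsWeakCouplings : Theory → Set₁
AdmitsWeakCouplings T =
  (P Q : Pos) (h : Carrier P → Carrier Q) → Monotone P Q h →
  (p q : Term (S T) (Carrier P)) →
  Le T (Pos._≤_ Q) (tmap h p) (tmap h q) →
  Σ[ r ∈ Term (S T) (Σ[ uv ∈ Carrier P × Carrier P ]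
                    Pos._≤_ Q (h (proj₁ uv)) (h (proj₂ uv))) ]
    (Le T (Pos._≤_ P) p (tmap (λ w → proj₁ (proj₁ w)) r)
     × Le T (Pos._≤_ P) (tmap (λ w → proj₂ (proj₁ w)) r) q)

Infinite : Set → Set
Infinite V = Σ[ f ∈ (ℕ → V) ] Injective _≡_ _≡_ f

module Behaviour (T : Theory) (Var Act : Set) where

  BOrd : {Y : Set} → (Y → Y → Set) → (Var ⊎ (Act × Y)) → (Var ⊎ (Act × Y)) → Set
  BOrd _≤_ (inj₁ v)       (inj₁ w)       = v ≡ w
  BOrd _≤_ (inj₁ v)       (inj₂ _)       = ⊥
  BOrd _≤_ (inj₂ _)       (inj₁ w)       = ⊥
  BOrd _≤_ (inj₂ (a , x)) (inj₂ (b , y)) = (a ≡ b) × (x ≤ y)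

  BMap : {Y Z : Set} → (Y → Z) → (Var ⊎ (Act × Y)) → (Var ⊎ (Act × Z))
  BMap h (inj₁ v)       = inj₁ v
  BMap h (inj₂ (a , y)) = inj₂ (a , h y)

  -- B_N X = N(Var + Act × X), with N = U M D; elements represented by terms
  BN : Set → Set
  BN X = Term (S T) (Var ⊎ (Act × X))

  record MonCoalg : Set₁ where
    field
      P    : Pos
      δ    : Carrier P → BN (Carrier P)
      mono : ∀ {y y'} → Pos._≤_ P y y' →
             Le T (BOrd (Pos._≤_ P)) (δ y) (δ y')

  IsMonHom : {X : Set} (ϑ : X → BN X) (C : MonCoalg) → (X → Carrier (MonCoalg.P C)) → Set
  IsMonHom {X} ϑ C h =
    (∀ {x x'} → x ≡ x' → Pos._≤_ (MonCoalg.P C) (h x) (h x'))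
    × (∀ x → Eq T (BOrd (Pos._≤_ (MonCoalg.P C)))
                 (MonCoalg.δ C (h x)) (tmap (BMap h) (ϑ x)))

  BehOrder : {X : Set} (ϑ : X → BN X) → X → X → Set₁
  BehOrder {X} ϑ x y =
    Σ[ C ∈ MonCoalg ]
    Σ[ h₁ ∈ (X → Carrier (MonCoalg.P C)) ]
    Σ[ h₂ ∈ (X → Carrier (MonCoalg.P C)) ]
      (IsMonHom ϑ C h₁ × IsMonHom ϑ C h₂
       × Pos._≤_ (MonCoalg.P C) (h₁ x) (h₂ y))

  InR : {X : Set} → (X → X → Set₁) → (Var ⊎ (Act × (X × X))) → Set₁
  InR R (inj₁ v)             = Lift _ ⊤
  InR R (inj₂ (a , (u , v))) = R u v

  IsSimulation : {X : Set} (ϑ : X → BN X) → (X → X → Set₁) → Set₁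
  IsSimulation {X} ϑ R =
    ∀ x y → R x y →
    Σ[ p ∈ Term (S T) (Var ⊎ (Act × (X × X))) ]
      (AllVars (InR R) p
       × Le T (BOrd _≡_) (ϑ x) (tmap (BMap proj₁) p)
       × Le T (BOrd _≡_) (tmap (BMap proj₂) p) (ϑ y))

{-# OPTIONS --safe #-}
-- Suppose x ≤! y is witnessed by homomorphisms h₁, h₂ into a monotone
-- coalgebra (Y, ≤, δ) with h₁ x ≤ h₂ y. Then
--   B h₁ (ϑ x) ≡ δ (h₁ x) ⊑ δ (h₂ y) ≡ B h₂ (ϑ y).
-- Tagging every leaf of ϑ x and ϑ y with the homomorphism to be applied to it
-- turns both sides into images of tagged terms under one monotone map, so a
-- weak coupling of the tagged terms exists. Its leaves are pairs (u, v) with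
-- hᵢ u ≤ hⱼ v, that is u ≤! v, and forgetting the tags yields the term
-- required of a simulation.
module Submission where

open import Defs
open import Data.Bool using (Bool; true; false)
open import Data.Fin using (Fin)
open import Data.Nat using (ℕ)
open import Data.Product using (Σ-syntax; _×_; _,_; proj₁; proj₂; swap)
open import Data.Sum using (_⊎_; inj₁; inj₂)
open import Data.Unit using (tt)
open import Function using (_∘_; id)
open import Level using (lift)
open import Relation.Binary.Bundles using (Preorder)
open import Relation.Binary.Definitions using (Reflexive)
open import Relation.Binary.PropositionalEquality using (_≡_; refl; cong)
import Relation.Binary.PropositionalEquality.Properties as ≡
open import Relation.Binary.Structures using (IsEquivalence; IsPreorder; IsPartialOrder)

module Terms (T : Theory) where

  module _ {A : Set} {R : A → A → Set} where

    Eq-isEquivalence : IsEquivalence (Eq T R)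
    Eq-isEquivalence = record
      { refl  = ⊑-refl , ⊑-refl
      ; sym   = swap
      ; trans = λ (p⊑q , q⊑p) (q⊑r , r⊑q) → ⊑-trans p⊑q q⊑r , ⊑-trans r⊑q q⊑p
      }

    Le-isPreorder : IsPreorder (Eq T R) (Le T R)
    Le-isPreorder = record
      { isEquivalence = Eq-isEquivalence
      ; reflexive     = proj₁
      ; trans         = ⊑-trans
      }

    Eq-reflexive : ∀ {p q} → p ≡ q → Eq T R p q
    Eq-reflexive refl = ⊑-refl , ⊑-refl

    Eq-cong : ∀ {n} (o : Op (S T) n) {ps qs : Fin n → Term (S T) A} →
              (∀ i → Eq T R (ps i) (qs i)) → Eq T R (op o ps) (op o qs)
    Eq-cong o ps≈qs = ⊑-cong o (proj₁ ∘ ps≈qs) , ⊑-cong o (proj₂ ∘ ps≈qs)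

  Le-preorder : {A : Set} → (A → A → Set) → Preorder _ _ _
  Le-preorder R = record { isPreorder = Le-isPreorder {R = R} }

  module ⊑-Reasoning {A : Set} (R : A → A → Set) where
    open import Relation.Binary.Reasoning.Preorder (Le-preorder R) public

  module _ {A B : Set} {R : B → B → Set} where

    tmap-cong : {f g : A → B} → (∀ a → f a ≡ g a) →
                ∀ t → Eq T R (tmap f t) (tmap g t)
    tmap-cong f≗g (var a)   = Eq-reflexive (cong var (f≗g a))
    tmap-cong f≗g (op o ts) = Eq-cong o (tmap-cong f≗g ∘ ts)

    tmap-bind : (f : A → B) (σ : ℕ → Term (S T) A) →
                ∀ t → Eq T R (tmap f (bind σ t)) (bind (tmap f ∘ σ) t)
    tmap-bind f σ (var n)   = ⊑-refl , ⊑-refl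
    tmap-bind f σ (op o ts) = Eq-cong o (tmap-bind f σ ∘ ts)

  tmap-id : {A : Set} {R : A → A → Set} → ∀ t → Eq T R (tmap id t) t
  tmap-id (var a)   = ⊑-refl , ⊑-refl
  tmap-id (op o ts) = Eq-cong o (tmap-id ∘ ts)

  tmap-∘ : {A B C : Set} {R : C → C → Set} {f : B → C} {g : A → B} →
           ∀ t → Eq T R (tmap f (tmap g t)) (tmap (f ∘ g) t)
  tmap-∘ (var a)   = ⊑-refl , ⊑-refl
  tmap-∘ (op o ts) = Eq-cong o (tmap-∘ ∘ ts)

  tmap-mono : {A B : Set} {R : A → A → Set} {R′ : B → B → Set} (f : A → B) →
              (∀ {a b} → R a b → R′ (f a) (f b)) →
              ∀ {p q} → Le T R p q → Le T R′ (tmap f p) (tmap f q)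
  tmap-mono f f-mono (⊑-var a≤b)         = ⊑-var (f-mono a≤b)
  tmap-mono f f-mono (⊑-cong o ps⊑qs)    = ⊑-cong o (tmap-mono f f-mono ∘ ps⊑qs)
  tmap-mono f f-mono (⊑-op ps o₁≤o₂)     = ⊑-op (tmap f ∘ ps) o₁≤o₂
  tmap-mono f f-mono (⊑-ax {p} {q} pq σ) =
    ⊑-trans (proj₁ (tmap-bind f σ p)) (⊑-trans (⊑-ax pq (tmap f ∘ σ)) (proj₂ (tmap-bind f σ q)))
  tmap-mono f f-mono ⊑-refl              = ⊑-refl
  tmap-mono f f-mono (⊑-trans p⊑q q⊑r)   = ⊑-trans (tmap-mono f f-mono p⊑q) (tmap-mono f f-mono q⊑r)

  AllVars-tmap : ∀ {ℓ} {A B : Set} {P : B → Set ℓ} (f : A → B) →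
                 (∀ a → P (f a)) → ∀ t → AllVars {S = S T} P (tmap f t)
  AllVars-tmap f Pf (var a)   = Pf a
  AllVars-tmap f Pf (op o ts) = λ i → AllVars-tmap f Pf (ts i)

module BehaviourProperties (T : Theory) (Var Act : Set) where
  open Behaviour T Var Act

  BMap-id : {A : Set} → ∀ w → BMap {A} id w ≡ w
  BMap-id (inj₁ v)       = refl
  BMap-id (inj₂ (a , x)) = refl

  BMap-∘ : {A B C : Set} {f : B → C} {g : A → B} → ∀ w → BMap f (BMap g w) ≡ BMap (f ∘ g) w
  BMap-∘ (inj₁ v)       = refl
  BMap-∘ (inj₂ (a , x)) = refl

  BOrd-reflexive : {A : Set} {R : A → A → Set} → Reflexive R → ∀ {w w′} → w ≡ w′ → BOrd R w w′
  BOrd-reflexive R-refl {inj₁ v}       refl = refl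
  BOrd-reflexive R-refl {inj₂ (a , x)} refl = refl , R-refl

  BOrd-isPartialOrder : {A : Set} {R : A → A → Set} →
                        IsPartialOrder _≡_ R → IsPartialOrder _≡_ (BOrd R)
  BOrd-isPartialOrder {A} {R} R-po = record
    { isPreorder = record
      { isEquivalence = ≡.isEquivalence
      ; reflexive     = BOrd-reflexive R.refl
      ; trans         = BOrd-trans
      }
    ; antisym = BOrd-antisym
    }
    where
    module R = IsPartialOrder R-po

    BOrd-trans : ∀ {u v w} → BOrd R u v → BOrd R v w → BOrd R u w
    BOrd-trans {inj₁ _} {inj₁ _} {inj₁ _} refl refl = refl
    BOrd-trans {inj₂ _} {inj₂ _} {inj₂ _} (refl , x≤y) (refl , y≤z) = refl , R.trans x≤y y≤z

    BOrd-antisym : ∀ {u v} → BOrd R u v → BOrd R v u → u ≡ v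
    BOrd-antisym {inj₁ _}       {inj₁ _} refl _ = refl
    BOrd-antisym {inj₂ (a , _)} {inj₂ _} (refl , x≤y) (_ , y≤x) = cong (inj₂ ∘ (a ,_)) (R.antisym x≤y y≤x)

  BPos : Pos → Pos
  BPos P = record
    { Carrier        = Var ⊎ (Act × Carrier P)
    ; _≤_            = BOrd (Pos._≤_ P)
    ; isPartialOrder = BOrd-isPartialOrder (Pos.isPartialOrder P)
    }

  open Terms T

  tmap-BMap-∘ : {A B C : Set} {R : Var ⊎ (Act × C) → Var ⊎ (Act × C) → Set}
                {f : B → C} {g : A → B} →
                ∀ t → Eq T R (tmap (BMap f) (tmap (BMap g) t)) (tmap (BMap (f ∘ g)) t)
  tmap-BMap-∘ t = IsEquivalence.trans Eq-isEquivalence (tmap-∘ t) (tmap-cong BMap-∘ t)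

module _ (T : Theory) (Var Act : Set) where
  open Behaviour T Var Act
  open BehaviourProperties T Var Act
  open Terms T

  SimulationStep : {X : Set} → (X → BN X) → (X → X → Set₁) → X → X → Set₁
  SimulationStep {X} ϑ R x y =
    Σ[ p ∈ Term (S T) (Var ⊎ (Act × (X × X))) ]
      (AllVars (InR R) p
       × Le T (BOrd _≡_) (ϑ x) (tmap (BMap proj₁) p)
       × Le T (BOrd _≡_) (tmap (BMap proj₂) p) (ϑ y))

  module _ (couplings : AdmitsWeakCouplings T) {X : Set} (ϑ : X → BN X) (C : MonCoalg)
           {I : Set} (hom : I → X → Carrier (MonCoalg.P C))
           (hom-isMonHom : ∀ i → IsMonHom ϑ C (hom i)) where
    open MonCoalg C

    private
      Tagged : Set
      Tagged = Var ⊎ (Act × (I × X))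

      untag : I × X → X
      untag = proj₂

      hom-tagged : I × X → Carrier P
      hom-tagged (i , x) = hom i x

      Discrete : Pos
      Discrete = record { Carrier = Tagged ; _≤_ = _≡_ ; isPartialOrder = ≡.isPartialOrder }

      BMap-hom-tagged-mono : Monotone Discrete (BPos P) (BMap hom-tagged)
      BMap-hom-tagged-mono u≡v =
        BOrd-reflexive (IsPartialOrder.refl (Pos.isPartialOrder P)) (cong (BMap hom-tagged) u≡v)

      BMap-untag-mono : ∀ {u v : Tagged} → u ≡ v → BOrd _≡_ (BMap untag u) (BMap untag v)
      BMap-untag-mono u≡v = BOrd-reflexive refl (cong (BMap untag) u≡v)

      untag-tag : ∀ i t → Eq T (BOrd _≡_) (tmap (BMap untag) (tmap (BMap (i ,_)) t)) t
      untag-tag i t = begin-equality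
        tmap (BMap untag) (tmap (BMap (i ,_)) t) ≈⟨ tmap-BMap-∘ t ⟩
        tmap (BMap id) t                          ≈⟨ tmap-cong BMap-id t ⟩
        tmap id t                                 ≈⟨ tmap-id t ⟩
        t                                         ∎
        where open ⊑-Reasoning (BOrd _≡_)

    simulationStep-homomorphic : ∀ {i j x y} → Pos._≤_ P (hom i x) (hom j y) →
                                 SimulationStep ϑ (BehOrder ϑ) x y
    simulationStep-homomorphic {i} {j} {x} {y} hom-x≤hom-y =
      tmap leaf r , AllVars-tmap leaf leaf-related r , lower , upper
      where
      tagged-x tagged-y : Term (S T) Tagged
      tagged-x = tmap (BMap (i ,_)) (ϑ x)
      tagged-y = tmap (BMap (j ,_)) (ϑ y)

      images-ordered : Le T (BOrd (Pos._≤_ P))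
                         (tmap (BMap hom-tagged) tagged-x) (tmap (BMap hom-tagged) tagged-y)
      images-ordered = begin
        tmap (BMap hom-tagged) tagged-x ≈⟨ tmap-BMap-∘ (ϑ x) ⟩
        tmap (BMap (hom i)) (ϑ x)       ≈⟨ proj₂ (hom-isMonHom i) x ⟨
        δ (hom i x)                     ≲⟨ mono hom-x≤hom-y ⟩
        δ (hom j y)                     ≈⟨ proj₂ (hom-isMonHom j) y ⟩
        tmap (BMap (hom j)) (ϑ y)       ≈⟨ tmap-BMap-∘ (ϑ y) ⟨
        tmap (BMap hom-tagged) tagged-y ∎
        where open ⊑-Reasoning (BOrd (Pos._≤_ P))

      Pair : Set
      Pair = Σ[ uv ∈ Tagged × Tagged ]
               BOrd (Pos._≤_ P) (BMap hom-tagged (proj₁ uv)) (BMap hom-tagged (proj₂ uv))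

      coupling : Σ[ r ∈ Term (S T) Pair ]
                   (Le T _≡_ tagged-x (tmap (proj₁ ∘ proj₁) r)
                    × Le T _≡_ (tmap (proj₂ ∘ proj₁) r) tagged-y)
      coupling = couplings Discrete (BPos P) (BMap hom-tagged) BMap-hom-tagged-mono
                           tagged-x tagged-y images-ordered

      r : Term (S T) Pair
      r = proj₁ coupling

      tagged-x⊑r₁ : Le T _≡_ tagged-x (tmap (proj₁ ∘ proj₁) r)
      tagged-x⊑r₁ = proj₁ (proj₂ coupling)

      r₂⊑tagged-y : Le T _≡_ (tmap (proj₂ ∘ proj₁) r) tagged-y
      r₂⊑tagged-y = proj₂ (proj₂ coupling)

      leaf : Pair → Var ⊎ (Act × (X × X))
      leaf ((inj₁ v , inj₁ _) , _)                         = inj₁ v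
      leaf ((inj₂ (a , (_ , u)) , inj₂ (_ , (_ , v))) , _) = inj₂ (a , (u , v))

      leaf-related : ∀ w → InR (BehOrder ϑ) (leaf w)
      leaf-related ((inj₁ _ , inj₁ _) , _) = lift tt
      leaf-related ((inj₂ (_ , (i′ , _)) , inj₂ (_ , (j′ , _))) , (_ , u≤v)) =
        C , hom i′ , hom j′ , hom-isMonHom i′ , hom-isMonHom j′ , u≤v

      leaf-left : ∀ w → BMap untag (proj₁ (proj₁ w)) ≡ BMap proj₁ (leaf w)
      leaf-left ((inj₁ _ , inj₁ _) , _) = refl
      leaf-left ((inj₂ _ , inj₂ _) , _) = refl

      leaf-right : ∀ w → BMap proj₂ (leaf w) ≡ BMap untag (proj₂ (proj₁ w))
      leaf-right ((inj₁ _ , inj₁ _) , v≡v′)       = cong inj₁ v≡v′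
      leaf-right ((inj₂ _ , inj₂ _) , (refl , _)) = refl

      lower : Le T (BOrd _≡_) (ϑ x) (tmap (BMap proj₁) (tmap leaf r))
      lower = begin
        ϑ x                                               ≈⟨ untag-tag i (ϑ x) ⟨
        tmap (BMap untag) tagged-x                        ≲⟨ tmap-mono (BMap untag) BMap-untag-mono tagged-x⊑r₁ ⟩
        tmap (BMap untag) (tmap (proj₁ ∘ proj₁) r)        ≈⟨ tmap-∘ r ⟩
        tmap (BMap untag ∘ proj₁ ∘ proj₁) r               ≈⟨ tmap-cong leaf-left r ⟩
        tmap (BMap proj₁ ∘ leaf) r                        ≈⟨ tmap-∘ r ⟨
        tmap (BMap proj₁) (tmap leaf r)                   ∎
        where open ⊑-Reasoning (BOrd _≡_)

      upper : Le T (BOrd _≡_) (tmap (BMap proj₂) (tmap leaf r)) (ϑ y)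
      upper = begin
        tmap (BMap proj₂) (tmap leaf r)                   ≈⟨ tmap-∘ r ⟩
        tmap (BMap proj₂ ∘ leaf) r                        ≈⟨ tmap-cong leaf-right r ⟩
        tmap (BMap untag ∘ proj₂ ∘ proj₁) r               ≈⟨ tmap-∘ r ⟨
        tmap (BMap untag) (tmap (proj₂ ∘ proj₁) r)        ≲⟨ tmap-mono (BMap untag) BMap-untag-mono r₂⊑tagged-y ⟩
        tmap (BMap untag) tagged-y                        ≈⟨ untag-tag j (ϑ y) ⟩
        ϑ y                                               ∎
        where open ⊑-Reasoning (BOrd _≡_)

lemma8p5 : (T : Theory) (Var Act : Set) → Infinite Var →
           AdmitsWeakCouplings T →
           (X : Set) (ϑ : X → Behaviour.BN T Var Act X) →
           Behaviour.IsSimulation T Var Act ϑ (Behaviour.BehOrder T Var Act ϑ)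
lemma8p5 T Var Act _ couplings X ϑ x y (C , h₁ , h₂ , h₁-isMonHom , h₂-isMonHom , h₁x≤h₂y) =
  simulationStep-homomorphic T Var Act couplings ϑ C hom hom-isMonHom {true} {false} h₁x≤h₂y
  where
  open Behaviour T Var Act

  hom : Bool → X → Carrier (MonCoalg.P C)
  hom true  = h₁
  hom false = h₂

  hom-isMonHom : ∀ b → IsMonHom ϑ C (hom b)
  hom-isMonHom true  = h₁-isMonHom
  hom-isMonHom false = h₂-isMonHom
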